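{- Let $\Delta\in\mathbb{N}$. On trees of maximum degree at least $\Delta+1$, the radius algorithm computes a $\Delta$-periodic labeling of minimum possible stretch; and on arbitrary trees the radius algorithm is a 2-approximation algorithm for the minimum stretch.
   Context: A $\Delta$-periodic labeling of $G=(V,E)$ is a function $\lambda:E\to\{1,\dots,\Delta\}$; edge $e$ is available exactly at times $\lambda(e)+i\Delta$, $i\ge0$. A temporal path from $s$ to $z$ is a path $s=v_0,\dots,v_k=z$ with distinct vertices and times $t_1<\dots<t_k$ with $\{v_{i-1},v_i\}$ available at $t_i$; its duration is $t_k-t_1+1$. The stretch of $\lambda$ is the maximum over ordered pairs of distinct vertices $(u,v)$ of (minimum duration of a temporal path from $u$ to $v$)$/\operatorname{dist}_G(u,v)$. The radius algorithm: choose a vertex $v_x$ of eccentricity equal to the radius $\mathrm{rad}$; for each $i\in\{1,\dots,\mathrm{rad}\}$, give every edge joining a vertex at distance $i-1$ from $v_x$ to a vertex at distance $i$ from $v_x$ the label $\lceil\Delta/2\rceil$ if $i$ is odd and $\Delta$ if $i$ is even; label all other edges arbitrarily. -}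

module Defs where

open import Data.Nat using (ℕ; zero; suc; _+_; _*_; _∸_; _≤_; _<_; _⊔_; ⌈_/2⌉; _%_; _≡ᵇ_)
open import Data.Bool using (Bool; true; false; if_then_else_)
open import Data.Fin using (Fin; inject₁; fromℕ) renaming (zero to fzero; suc to fsuc)
open import Data.List using (List; map; foldr; allFin)
open import Data.Nat.ListAction using (sum)
open import Data.Product using (Σ; ∃; _×_; _,_)
open import Data.Integer using (+_)
open import Data.Rational using (ℚ; _/_) renaming (_≤_ to _≤ℚ_)
open import Relation.Binary.PropositionalEquality using (_≡_; _≢_)
open import Relation.Nullary using (¬_)
open import Function.Definitions using (Injective)

record Graph (n : ℕ) : Set where
  field
    adj    : Fin n → Fin n → Bool
    sym    : ∀ u v → adj u v ≡ adj v u
    irrefl : ∀ u → adj u u ≡ false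

open Graph public

Edge : ∀ {n} → Graph n → Fin n → Fin n → Set
Edge G u v = adj G u v ≡ true

record Path {n : ℕ} (G : Graph n) (s z : Fin n) (k : ℕ) : Set where
  field
    vtx      : Fin (suc k) → Fin n
    start    : vtx fzero ≡ s
    end      : vtx (fromℕ k) ≡ z
    adjacent : ∀ (i : Fin k) → Edge G (vtx (inject₁ i)) (vtx (fsuc i))
    distinct : Injective _≡_ _≡_ vtx

open Path public

Dist : ∀ {n} → Graph n → Fin n → Fin n → ℕ → Set
Dist G u v d = Path G u v d × (∀ k → Path G u v k → d ≤ k)

Connected : ∀ {n} → Graph n → Set
Connected {n} G = ∀ (u v : Fin n) → ∃ λ k → Path G u v k

-- a cycle: a path with at least 3 vertices whose endpoints are adjacent
Acyclic : ∀ {n} → Graph n → Set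
Acyclic {n} G = ∀ (u v : Fin n) (k : ℕ) → Path G u v (suc (suc k)) → ¬ Edge G v u

Tree : ∀ {n} → Graph n → Set
Tree G = Connected G × Acyclic G

degree : ∀ {n} → Graph n → Fin n → ℕ
degree {n} G v = sum (map (λ u → if adj G v u then 1 else 0) (allFin n))

maxDegree : ∀ {n} → Graph n → ℕ
maxDegree {n} G = foldr _⊔_ 0 (map (degree G) (allFin n))

-- Δ-periodic labelings. A labeling is a symmetric function on vertex
-- pairs; only its values on edges matter, and those lie in {1,…,Δ}.

Labeling : ℕ → Set
Labeling n = Fin n → Fin n → ℕ

PeriodicLabeling : ∀ {n} → Graph n → ℕ → Labeling n → Set
PeriodicLabeling {n} G Δ lab =
  ∀ (u v : Fin n) → Edge G u v → (lab u v ≡ lab v u) × (1 ≤ lab u v) × (lab u v ≤ Δ)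

Available : ∀ {n} → ℕ → Labeling n → Fin n → Fin n → ℕ → Set
Available Δ lab u v t = ∃ λ (i : ℕ) → t ≡ lab u v + i * Δ

TemporalPath : ∀ {n} → Graph n → ℕ → Labeling n → Fin n → Fin n → ℕ → Set
TemporalPath G Δ lab s z D =
  Σ ℕ λ k → Σ (Path G s z (suc k)) λ p → Σ (Fin (suc k) → ℕ) λ t →
      (∀ (i : Fin k) → t (inject₁ i) < t (fsuc i))
    × (∀ (i : Fin (suc k)) → Available Δ lab (vtx p (inject₁ i)) (vtx p (fsuc i)) (t i))
    × (D ≡ t (fromℕ k) ∸ t fzero + 1)

MinDuration : ∀ {n} → Graph n → ℕ → Labeling n → Fin n → Fin n → ℕ → Set
MinDuration G Δ lab s z D =
  TemporalPath G Δ lab s z D × (∀ D′ → TemporalPath G Δ lab s z D′ → D ≤ D′)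

PairRatio : ∀ {n} → Graph n → ℕ → Labeling n → Fin n → Fin n → ℚ → Set
PairRatio G Δ lab u v r =
  (u ≢ v) × Σ ℕ λ D → Σ ℕ λ d →
    MinDuration G Δ lab u v D × Dist G u v (suc d) × (r ≡ (+ D) / suc d)

IsStretch : ∀ {n} → Graph n → ℕ → Labeling n → ℚ → Set
IsStretch {n} G Δ lab s =
  (Σ (Fin n) λ u → Σ (Fin n) λ v → PairRatio G Δ lab u v s)
  × (∀ u v r → PairRatio G Δ lab u v r → r ≤ℚ s)

Eccentricity : ∀ {n} → Graph n → Fin n → ℕ → Set
Eccentricity {n} G v e =
  (∀ (u : Fin n) d → Dist G v u d → d ≤ e) × (Σ (Fin n) λ u → Dist G v u e)

IsCenter : ∀ {n} → Graph n → Fin n → Set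
IsCenter {n} G v =
  Σ ℕ λ e → Eccentricity G v e × (∀ (w : Fin n) e′ → Eccentricity G w e′ → e ≤ e′)

-- label of an edge joining distance i-1 to distance i (i ≥ 1)
levelLabel : ℕ → ℕ → ℕ
levelLabel Δ i = if (i % 2 ≡ᵇ 1) then ⌈ Δ /2⌉ else Δ

-- lab is a possible output of the radius algorithm with chosen center vx:
-- it is a Δ-periodic labeling (other edges labelled arbitrarily) and every
-- edge joining distance i to distance i+1 from vx gets levelLabel Δ (i+1).
RadiusLabeling : ∀ {n} → Graph n → ℕ → Fin n → Labeling n → Set
RadiusLabeling {n} G Δ vx lab =
  IsCenter G vx × PeriodicLabeling G Δ lab
  × (∀ (a b : Fin n) (i : ℕ) → Edge G a b → Dist G vx a i → Dist G vx b (suc i)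
       → lab a b ≡ levelLabel Δ (suc i))

module Submission where

-- In a tree the path between two vertices is unique, so the fastest temporal path
-- departs along each edge of that path as soon as it is available, and its duration
-- is one more than the sum of the waits between consecutive labels.  Under the
-- radius labeling the levels along the path first decrease and then increase, so the
-- labels alternate between ⌈Δ/2⌉ and Δ, with waits ⌈Δ/2⌉ and ⌊Δ/2⌋, except for one
-- repeated label at the lowest vertex, with wait Δ; this bounds the duration of a
-- pair at distance d by (Δ+1)d/2.  Conversely, every Δ-periodic labeling repeats a
-- label at a vertex of degree > Δ, giving two vertices at distance 2 with duration
-- Δ+1; and on every path x–c–y the waits from x to y and from y to x add up to at
-- least Δ, so one of these two pairs has ratio at least (Δ+2)/4.

open import Defs hiding (sym)
open import Data.Nat using (ℕ; zero; suc; _+_; _∸_; _≤_; _<_; _<?_; _≤?_; z≤n; s≤s; ⌈_/2⌉; ⌊_/2⌋)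
open import Data.Nat.Properties
open import Data.Nat.Tactic.RingSolver using (solve-∀)
open import Data.Nat.ListAction using (sum)
open import Algebra.Properties.CommutativeSemigroup +-commutativeSemigroup
  using (xy∙z≈xz∙y; x∙yz≈yx∙z; interchange)
open import Data.Bool as Bool using (Bool; true; false; if_then_else_)
open import Data.Fin using (Fin; inject₁; fromℕ; fromℕ<; toℕ) renaming (zero to fzero; suc to fsuc)
import Data.Fin.Properties as Finₚ
open import Data.List as List using (List; []; _∷_; _∷ʳ_; map; filter; allFin; lookup; tabulate)
open import Data.List.Properties using (∷-injective; ∷ʳ-injectiveˡ; ∷ʳ-injectiveʳ)
open import Data.List.Membership.Propositional using (_∈_; _∉_)
open import Data.List.Membership.Propositional.Properties using (foldr-selective; ∈-map⁻; ∈-filter⁻; ∈-lookup)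
import Data.List.Membership.DecPropositional as DecMembership
open import Data.List.Relation.Unary.Any using (here; there)
open import Data.List.Relation.Unary.All as All using ([]; _∷_)
open import Data.List.Relation.Unary.All.Properties using (¬Any⇒All¬)
open import Data.List.Relation.Unary.AllPairs using ([]; _∷_)
open import Data.List.Relation.Unary.Unique.Propositional using (Unique)
import Data.List.Relation.Unary.Unique.Propositional.Properties as Unique
open import Data.List.Relation.Binary.Subset.Propositional using (_⊆_)
open import Data.Integer as ℤ using (+_; +≤+)
import Data.Integer.Properties as ℤ
open import Data.Rational as ℚ using (ℚ; _/_; toℚᵘ) renaming (_≤_ to _≤ℚ_)
import Data.Rational.Properties as ℚ
open import Data.Rational.Unnormalised as ℚᵘ using (mkℚᵘ; *≤*; *≡*) renaming (_≃_ to _≃ᵘ_)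
import Data.Rational.Unnormalised.Properties as ℚᵘ
open import Data.Product using (Σ; ∃; ∃₂; _×_; _,_; proj₁; proj₂)
open import Data.Sum using (_⊎_; inj₁; inj₂)
open import Data.Empty using (⊥; ⊥-elim)
open import Relation.Nullary using (yes; no; contradiction)
open import Relation.Binary.Definitions using (tri<; tri≈; tri>)
open import Relation.Binary.PropositionalEquality
open import Relation.Binary.Construct.Closure.ReflexiveTransitive using (Star; ε; _◅_; _◅◅_; revApp; reverse)

module Walks {n : ℕ} (G : Graph n) where

  open DecMembership (Finₚ._≟_ {n}) using (_∈?_)

  Edge-sym : ∀ {u v} → Edge G u v → Edge G v u
  Edge-sym {u} {v} e = trans (Graph.sym G v u) e

  Edge⇒≢ : ∀ {u v} → Edge G u v → u ≢ v
  Edge⇒≢ {u} e refl with trans (sym e) (irrefl G u)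
  ... | ()

  Walk : Fin n → Fin n → Set
  Walk = Star (Edge G)

  vertices : ∀ {u v} → Walk u v → List (Fin n)
  vertices {u} ε       = u ∷ []
  vertices {u} (_ ◅ p) = u ∷ vertices p

  length : ∀ {u v} → Walk u v → ℕ
  length ε       = 0
  length (_ ◅ p) = suc (length p)

  Simple : ∀ {u v} → Walk u v → Set
  Simple p = Unique (vertices p)

  start∈ : ∀ {u v} (p : Walk u v) → u ∈ vertices p
  start∈ ε       = here refl
  start∈ (_ ◅ _) = here refl

  end∈ : ∀ {u v} (p : Walk u v) → v ∈ vertices p
  end∈ ε       = here refl
  end∈ (_ ◅ p) = there (end∈ p)

  vertices-∷ʳ : ∀ {u v} (p : Walk u v) → ∃ λ xs → vertices p ≡ xs ∷ʳ v
  vertices-∷ʳ ε = [] , refl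
  vertices-∷ʳ {u} (_ ◅ p) with xs , eq ← vertices-∷ʳ p = u ∷ xs , cong (u ∷_) eq

  length-vertices : ∀ {u v} (p : Walk u v) → List.length (vertices p) ≡ suc (length p)
  length-vertices ε       = refl
  length-vertices (_ ◅ p) = cong suc (length-vertices p)

  same-vertices⇒same-end : ∀ {u u′ v v′} (p : Walk u v) (q : Walk u′ v′) →
                           vertices p ≡ vertices q → v ≡ v′
  same-vertices⇒same-end p q eq with xs , p≡ ← vertices-∷ʳ p | ys , q≡ ← vertices-∷ʳ q =
    ∷ʳ-injectiveʳ xs ys (trans (sym p≡) (trans eq q≡))

  cons-simple : ∀ {u v w} (e : Edge G u v) (p : Walk v w) → u ∉ vertices p → Simple p → Simple (e ◅ p)
  cons-simple e p u∉p simple = ¬Any⇒All¬ (vertices p) u∉p ∷ simple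

  ∈-◅◅⁻ : ∀ {u v w x} (p : Walk u v) (q : Walk v w) →
          x ∈ vertices (p ◅◅ q) → x ∈ vertices p ⊎ x ∈ vertices q
  ∈-◅◅⁻ ε       q x∈         = inj₂ x∈
  ∈-◅◅⁻ (_ ◅ p) q (here refl) = inj₁ (here refl)
  ∈-◅◅⁻ (_ ◅ p) q (there x∈) with ∈-◅◅⁻ p q x∈
  ... | inj₁ x∈p = inj₁ (there x∈p)
  ... | inj₂ x∈q = inj₂ x∈q

  ∈-revApp⁻ : ∀ {i j k x} (p : Walk j i) (q : Walk j k) →
              x ∈ vertices (revApp Edge-sym p q) → x ∈ vertices p ⊎ x ∈ vertices q
  ∈-revApp⁻ ε       q x∈ = inj₂ x∈
  ∈-revApp⁻ (e ◅ p) q x∈ with ∈-revApp⁻ p (Edge-sym e ◅ q) x∈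
  ... | inj₁ x∈p         = inj₁ (there x∈p)
  ... | inj₂ (here refl) = inj₁ (there (start∈ p))
  ... | inj₂ (there x∈q) = inj₂ x∈q

  ∈-reverse⁻ : ∀ {u v x} (p : Walk u v) → x ∈ vertices (reverse Edge-sym p) → x ∈ vertices p
  ∈-reverse⁻ p x∈ with ∈-revApp⁻ p ε x∈
  ... | inj₁ x∈p         = x∈p
  ... | inj₂ (here refl) = start∈ p

  suffix : ∀ {u v x} (p : Walk u v) → x ∈ vertices p →
           Σ (Walk x v) λ q → vertices q ⊆ vertices p × (Simple p → Simple q)
  suffix ε       (here refl) = ε , (λ y∈ → y∈) , (λ s → s)
  suffix (e ◅ p) (here refl) = e ◅ p , (λ y∈ → y∈) , (λ s → s)
  suffix (_ ◅ p) (there x∈) with q , q⊆p , simple ← suffix p x∈ =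
    q , (λ y∈ → there (q⊆p y∈)) , λ { (_ ∷ s) → simple s }

  prefix : ∀ {u v x} (p : Walk u v) → x ∈ vertices p → x ≢ v →
           Σ (Walk u x) λ q → vertices q ⊆ vertices p × (Simple p → Simple q) × length q < length p
  prefix ε       (here refl) x≢v = ⊥-elim (x≢v refl)
  prefix (_ ◅ _) (here refl) _   = ε , (λ { (here refl) → here refl }) , (λ _ → [] ∷ []) , s≤s z≤n
  prefix (e ◅ p) (there x∈) x≢v with q , q⊆p , simple , shorter ← prefix p x∈ x≢v =
    e ◅ q ,
    (λ { (here refl) → here refl ; (there y∈) → there (q⊆p y∈) }) ,
    (λ { (u∉p ∷ s) → All.tabulate (λ y∈ → All.lookup u∉p (q⊆p y∈)) ∷ simple s }) ,
    s≤s shorter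

  loopErase : ∀ {u v} (p : Walk u v) → Σ (Walk u v) λ q → Simple q × vertices q ⊆ vertices p
  loopErase ε = ε , [] ∷ [] , (λ x∈ → x∈)
  loopErase {u} (e ◅ p) with q , simple , q⊆p ← loopErase p with u ∈? vertices q
  ... | yes u∈q with q′ , q′⊆q , simple′ ← suffix q u∈q =
    q′ , simple′ simple , λ x∈ → there (q⊆p (q′⊆q x∈))
  ... | no u∉q =
    e ◅ q , cons-simple e q u∉q simple , λ { (here refl) → here refl ; (there x∈) → there (q⊆p x∈) }

  snoc : ∀ {u v w} → Walk u v → Edge G v w → Walk u w
  snoc p e = p ◅◅ e ◅ ε

  vertices-snoc : ∀ {u v w} (p : Walk u v) (e : Edge G v w) → vertices (snoc p e) ≡ vertices p ∷ʳ w
  vertices-snoc ε       e = refl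
  vertices-snoc {u} (_ ◅ p) e = cong (u ∷_) (vertices-snoc p e)

  length-snoc : ∀ {u v w} (p : Walk u v) (e : Edge G v w) → length (snoc p e) ≡ suc (length p)
  length-snoc ε       e = refl
  length-snoc (_ ◅ p) e = cong suc (length-snoc p e)

  snoc-simple : ∀ {u v w} (p : Walk u v) (e : Edge G v w) → Simple p → w ∉ vertices p → Simple (snoc p e)
  snoc-simple p e simple w∉p = subst Unique (sym (vertices-snoc p e))
    (Unique.++⁺ simple ([] ∷ []) λ { (w∈p , here refl) → w∉p w∈p })

  walkAlong : ∀ k (f : Fin (suc k) → Fin n) → (∀ i → Edge G (f (inject₁ i)) (f (fsuc i))) →
              ∀ {u v} → f fzero ≡ u → f (fromℕ k) ≡ v → Walk u v
  walkAlong zero    f adj refl refl = ε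
  walkAlong (suc k) f adj refl v≡   = adj fzero ◅ walkAlong k (λ i → f (fsuc i)) (λ i → adj (fsuc i)) refl v≡

  vertices-walkAlong : ∀ k f adj {u v} (u≡ : f fzero ≡ u) (v≡ : f (fromℕ k) ≡ v) →
                       vertices (walkAlong k f adj u≡ v≡) ≡ tabulate f
  vertices-walkAlong zero    f adj refl refl = refl
  vertices-walkAlong (suc k) f adj refl v≡   =
    cong (f fzero ∷_) (vertices-walkAlong k (λ i → f (fsuc i)) (λ i → adj (fsuc i)) refl v≡)

  length-walkAlong : ∀ k f adj {u v} (u≡ : f fzero ≡ u) (v≡ : f (fromℕ k) ≡ v) →
                     length (walkAlong k f adj u≡ v≡) ≡ k
  length-walkAlong zero    f adj refl refl = refl
  length-walkAlong (suc k) f adj refl v≡   =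
    cong suc (length-walkAlong k (λ i → f (fsuc i)) (λ i → adj (fsuc i)) refl v≡)

  fromPath : ∀ {u v k} → Path G u v k → Walk u v
  fromPath {k = k} P = walkAlong k (vtx P) (adjacent P) (start P) (end P)

  vertices-fromPath : ∀ {u v k} (P : Path G u v k) → vertices (fromPath P) ≡ tabulate (vtx P)
  vertices-fromPath {k = k} P = vertices-walkAlong k (vtx P) (adjacent P) (start P) (end P)

  length-fromPath : ∀ {u v k} (P : Path G u v k) → length (fromPath P) ≡ k
  length-fromPath {k = k} P = length-walkAlong k (vtx P) (adjacent P) (start P) (end P)

  fromPath-simple : ∀ {u v k} (P : Path G u v k) → Simple (fromPath P)
  fromPath-simple P = subst Unique (sym (vertices-fromPath P)) (Unique.tabulate⁺ (distinct P))

  fromPath⁺ : ∀ {u v d} → Path G u v (suc d) →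
              ∃ λ b → Σ (Edge G u b) λ e → Σ (Walk b v) λ q → Simple (e ◅ q) × length q ≡ d
  fromPath⁺ P = split (fromPath P) (fromPath-simple P) (length-fromPath P)
    where
    split : ∀ {u v d} (p : Walk u v) → Simple p → length p ≡ suc d →
            ∃ λ b → Σ (Edge G u b) λ e → Σ (Walk b v) λ q → Simple (e ◅ q) × length q ≡ d
    split (e ◅ q) simple length≡ = _ , e , q , simple , suc-injective length≡

  path⇒twoStep : ∀ {u v d} → Path G u v (suc (suc d)) → ∃₂ λ c y → Edge G u c × Edge G c y × u ≢ y
  path⇒twoStep P with fromPath⁺ P
  ... | _ , e , ε     , _         , ()
  ... | _ , e , f ◅ q , u∉ ∷ _ , _ = _ , _ , e , f , All.lookup u∉ (there (start∈ q))

  vertexAt : ∀ {u v} (p : Walk u v) → Fin (suc (length p)) → Fin n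
  vertexAt {u} ε       _        = u
  vertexAt {u} (_ ◅ p) fzero    = u
  vertexAt     (_ ◅ p) (fsuc i) = vertexAt p i

  vertexAt-start : ∀ {u v} (p : Walk u v) → vertexAt p fzero ≡ u
  vertexAt-start ε       = refl
  vertexAt-start (_ ◅ _) = refl

  vertexAt-end : ∀ {u v} (p : Walk u v) → vertexAt p (fromℕ (length p)) ≡ v
  vertexAt-end ε       = refl
  vertexAt-end (_ ◅ p) = vertexAt-end p

  vertexAt-adjacent : ∀ {u v} (p : Walk u v) (i : Fin (length p)) →
                      Edge G (vertexAt p (inject₁ i)) (vertexAt p (fsuc i))
  vertexAt-adjacent (e ◅ p) fzero    = subst (Edge G _) (sym (vertexAt-start p)) e
  vertexAt-adjacent (_ ◅ p) (fsuc i) = vertexAt-adjacent p i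

  vertexAt∈ : ∀ {u v} (p : Walk u v) i → vertexAt p i ∈ vertices p
  vertexAt∈ ε       _        = here refl
  vertexAt∈ (_ ◅ p) fzero    = here refl
  vertexAt∈ (_ ◅ p) (fsuc i) = there (vertexAt∈ p i)

  vertexAt-injective : ∀ {u v} (p : Walk u v) → Simple p → ∀ {i j} → vertexAt p i ≡ vertexAt p j → i ≡ j
  vertexAt-injective ε       _          {fzero}  {fzero}  _  = refl
  vertexAt-injective (_ ◅ p) _          {fzero}  {fzero}  _  = refl
  vertexAt-injective (_ ◅ p) (u∉p ∷ _) {fzero}  {fsuc j} eq = ⊥-elim (All.lookup u∉p (vertexAt∈ p j) eq)
  vertexAt-injective (_ ◅ p) (u∉p ∷ _) {fsuc i} {fzero}  eq = ⊥-elim (All.lookup u∉p (vertexAt∈ p i) (sym eq))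
  vertexAt-injective (_ ◅ p) (_ ∷ s)   {fsuc i} {fsuc j} eq = cong fsuc (vertexAt-injective p s eq)

  toPath : ∀ {u v} (p : Walk u v) → Simple p → Path G u v (length p)
  toPath p simple = record
    { vtx      = vertexAt p
    ; start    = vertexAt-start p
    ; end      = vertexAt-end p
    ; adjacent = vertexAt-adjacent p
    ; distinct = vertexAt-injective p simple
    }

  module Acyclicity (acyclic : Acyclic G) where

    simple-walks-unique : ∀ {u v} (p q : Walk u v) → Simple p → Simple q → vertices p ≡ vertices q
    simple-walks-unique ε       ε       _           _           = refl
    simple-walks-unique ε       (_ ◅ q) _           (u∉q ∷ _)  = ⊥-elim (All.lookup u∉q (end∈ q) refl)
    simple-walks-unique (_ ◅ p) ε       (u∉p ∷ _)  _           = ⊥-elim (All.lookup u∉p (end∈ p) refl)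
    simple-walks-unique {u} (_◅_ {j = x} e p) (_◅_ {j = y} f q) (u∉p ∷ sp) (u∉q ∷ sq) with x Finₚ.≟ y
    ... | yes refl = cong (u ∷_) (simple-walks-unique p q sp sq)
    -- Leaving u along different edges u–x and u–y, the loop-erased walk x ⇝ v ⇝ y
    -- closes a cycle through u.
    ... | no x≢y   = ⊥-elim (closeCycle (loopErase (p ◅◅ reverse Edge-sym q)))
      where
      u∉pq : u ∉ vertices (p ◅◅ reverse Edge-sym q)
      u∉pq u∈ with ∈-◅◅⁻ p (reverse Edge-sym q) u∈
      ... | inj₁ u∈p = All.lookup u∉p u∈p refl
      ... | inj₂ u∈q = All.lookup u∉q (∈-reverse⁻ q u∈q) refl

      closeCycle : Σ (Walk x y) (λ r → Simple r × vertices r ⊆ vertices (p ◅◅ reverse Edge-sym q)) → ⊥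
      closeCycle (ε , _) = x≢y refl
      closeCycle (g ◅ r , simple , r⊆) = acyclic u y (length r)
        (toPath (e ◅ g ◅ r) (cons-simple e (g ◅ r) (λ u∈ → u∉pq (r⊆ u∈)) simple)) (Edge-sym f)

    simple-walk-lengths-equal : ∀ {u v} (p q : Walk u v) → Simple p → Simple q → length p ≡ length q
    simple-walk-lengths-equal p q sp sq = suc-injective (begin
      suc (length p)              ≡⟨ sym (length-vertices p) ⟩
      List.length (vertices p)    ≡⟨ cong List.length (simple-walks-unique p q sp sq) ⟩
      List.length (vertices q)    ≡⟨ length-vertices q ⟩
      suc (length q)              ∎)
      where open ≡-Reasoning

    path-lengths-equal : ∀ {u v k m} → Path G u v k → Path G u v m → k ≡ m
    path-lengths-equal P Q = begin
      _                      ≡⟨ sym (length-fromPath P) ⟩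
      length (fromPath P)    ≡⟨ simple-walk-lengths-equal _ _ (fromPath-simple P) (fromPath-simple Q) ⟩
      length (fromPath Q)    ≡⟨ length-fromPath Q ⟩
      _                      ∎
      where open ≡-Reasoning

    path⇒dist : ∀ {u v k} → Path G u v k → Dist G u v k
    path⇒dist P = P , λ _ Q → ≤-reflexive (path-lengths-equal P Q)

    module Levels (connected : Connected G) (r : Fin n) where

      level : Fin n → ℕ
      level a = proj₁ (connected r a)

      level-dist : ∀ a → Dist G r a (level a)
      level-dist a = path⇒dist (proj₂ (connected r a))

      simple⇒length≡level : ∀ {a} (p : Walk r a) → Simple p → length p ≡ level a
      simple⇒length≡level {a} p simple = path-lengths-equal (toPath p simple) (proj₂ (connected r a))

      rootWalk : ∀ a → Walk r a
      rootWalk a = fromPath (proj₂ (connected r a))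

      rootWalk-simple : ∀ a → Simple (rootWalk a)
      rootWalk-simple a = fromPath-simple (proj₂ (connected r a))

      ∈-rootWalk⇒< : ∀ {a b} → b ∈ vertices (rootWalk a) → b ≢ a → level b < level a
      ∈-rootWalk⇒< {a} b∈ b≢a with q , _ , simple , shorter ← prefix (rootWalk a) b∈ b≢a =
        subst₂ _<_ (simple⇒length≡level q (simple (rootWalk-simple a)))
                   (simple⇒length≡level (rootWalk a) (rootWalk-simple a)) shorter

      ∉-rootWalk⇒≡ : ∀ {a b} (e : Edge G a b) → b ∉ vertices (rootWalk a) → level b ≡ suc (level a)
      ∉-rootWalk⇒≡ {a} {b} e b∉ = begin
        level b                        ≡⟨ simple⇒length≡level (snoc (rootWalk a) e) extended ⟨
        length (snoc (rootWalk a) e)   ≡⟨ length-snoc (rootWalk a) e ⟩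
        suc (length (rootWalk a))      ≡⟨ cong suc (simple⇒length≡level (rootWalk a) (rootWalk-simple a)) ⟩
        suc (level a)                  ∎
        where
        open ≡-Reasoning
        extended : Simple (snoc (rootWalk a) e)
        extended = snoc-simple (rootWalk a) e (rootWalk-simple a) b∉

      edge-level-dichotomy : ∀ {a b} → Edge G a b → level b < level a ⊎ level b ≡ suc (level a)
      edge-level-dichotomy {a} {b} e with b ∈? vertices (rootWalk a)
      ... | yes b∈ = inj₁ (∈-rootWalk⇒< b∈ (Edge⇒≢ (Edge-sym e)))
      ... | no b∉  = inj₂ (∉-rootWalk⇒≡ e b∉)

      edge-level : ∀ {a b} → Edge G a b → level b ≡ suc (level a) ⊎ level a ≡ suc (level b)
      edge-level e with edge-level-dichotomy e | edge-level-dichotomy (Edge-sym e)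
      ... | inj₂ up  | _         = inj₁ up
      ... | inj₁ _   | inj₂ down = inj₂ down
      ... | inj₁ b<a | inj₁ a<b  = ⊥-elim (<-asym b<a a<b)

      parent-unique : ∀ {a b w} → Edge G a w → Edge G b w →
                      level w ≡ suc (level a) → level w ≡ suc (level b) → a ≡ b
      parent-unique {a} {b} {w} ea eb wa wb =
        same-vertices⇒same-end (rootWalk a) (rootWalk b) (∷ʳ-injectiveˡ _ _ (begin
          vertices (rootWalk a) ∷ʳ w        ≡⟨ vertices-snoc (rootWalk a) ea ⟨
          vertices (snoc (rootWalk a) ea)   ≡⟨ simple-walks-unique _ _ (extended ea wa) (extended eb wb) ⟩
          vertices (snoc (rootWalk b) eb)   ≡⟨ vertices-snoc (rootWalk b) eb ⟩
          vertices (rootWalk b) ∷ʳ w        ∎))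
        where
        open ≡-Reasoning
        extended : ∀ {c} (e : Edge G c w) → level w ≡ suc (level c) → Simple (snoc (rootWalk c) e)
        extended {c} e wc = snoc-simple _ e (rootWalk-simple c) λ w∈ →
          <-asym (∈-rootWalk⇒< w∈ (Edge⇒≢ (Edge-sym e))) (subst (level c <_) (sym wc) (n<1+n (level c)))

module Waiting (Δ : ℕ) where

  open import Data.Nat using (_*_)

  open ≤-Reasoning

  wait : ℕ → ℕ → ℕ
  wait a b with a <? b
  ... | yes _ = b ∸ a
  ... | no  _ = b + Δ ∸ a

  wait-< : ∀ {a b} → a < b → a + wait a b ≡ b
  wait-< {a} {b} a<b with a <? b
  ... | yes _   = m+[n∸m]≡n (<⇒≤ a<b)
  ... | no  a≮b = contradiction a<b a≮b

  wait-≥ : ∀ {a b} → b ≤ a → a ≤ b + Δ → a + wait a b ≡ b + Δ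
  wait-≥ {a} {b} b≤a a≤b+Δ with a <? b
  ... | yes a<b = contradiction b≤a (<⇒≱ a<b)
  ... | no  _   = m+[n∸m]≡n a≤b+Δ

  wait-cases : ∀ a b → a ≤ Δ → (a < b × a + wait a b ≡ b) ⊎ (b ≤ a × a + wait a b ≡ b + Δ)
  wait-cases a b a≤Δ with <-≤-connex a b
  ... | inj₁ a<b = inj₁ (a<b , wait-< a<b)
  ... | inj₂ b≤a = inj₂ (b≤a , wait-≥ b≤a (≤-trans a≤Δ (m≤n+m Δ b)))

  wait-self : ∀ a → wait a a ≡ Δ
  wait-self a = +-cancelˡ-≡ a _ _ (wait-≥ ≤-refl (m≤m+n a Δ))

  1≤wait : ∀ {a b} → a ≤ Δ → 1 ≤ b → 1 ≤ wait a b
  1≤wait {a} {b} a≤Δ 1≤b with wait-cases a b a≤Δ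
  ... | inj₁ (a<b , eq) = +-cancelˡ-≤ a 1 _ (begin
    a + 1          ≡⟨ +-comm a 1 ⟩
    suc a          ≤⟨ a<b ⟩
    b              ≡⟨ sym eq ⟩
    a + wait a b   ∎)
  ... | inj₂ (_ , eq) = +-cancelˡ-≤ a 1 _ (begin
    a + 1          ≤⟨ +-mono-≤ a≤Δ 1≤b ⟩
    Δ + b          ≡⟨ +-comm Δ b ⟩
    b + Δ          ≡⟨ sym eq ⟩
    a + wait a b   ∎)

  wait≤Δ : ∀ {a b} → a ≤ Δ → b ≤ Δ → wait a b ≤ Δ
  wait≤Δ {a} {b} a≤Δ b≤Δ with wait-cases a b a≤Δ
  ... | inj₁ (_ , eq) = m+n≤o⇒n≤o a (begin
    a + wait a b   ≡⟨ eq ⟩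
    b              ≤⟨ b≤Δ ⟩
    Δ              ∎)
  ... | inj₂ (b≤a , eq) = +-cancelˡ-≤ a _ Δ (begin
    a + wait a b   ≡⟨ eq ⟩
    b + Δ          ≤⟨ +-monoˡ-≤ Δ b≤a ⟩
    a + Δ          ∎)

  wait-available : ∀ {a b} → a ≤ Δ → ∀ i → ∃ λ j → a + i * Δ + wait a b ≡ b + j * Δ
  wait-available {a} {b} a≤Δ i with wait-cases a b a≤Δ
  ... | inj₁ (_ , eq) = i , (begin-equality
    a + i * Δ + wait a b   ≡⟨ xy∙z≈xz∙y a (i * Δ) (wait a b) ⟩
    a + wait a b + i * Δ   ≡⟨ cong (_+ i * Δ) eq ⟩
    b + i * Δ              ∎)
  ... | inj₂ (_ , eq) = suc i , (begin-equality
    a + i * Δ + wait a b   ≡⟨ xy∙z≈xz∙y a (i * Δ) (wait a b) ⟩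
    a + wait a b + i * Δ   ≡⟨ cong (_+ i * Δ) eq ⟩
    b + Δ + i * Δ          ≡⟨ +-assoc b Δ (i * Δ) ⟩
    b + suc i * Δ          ∎)

  wait-minimal : ∀ {a b} → a ≤ Δ → b ≤ Δ → ∀ i j →
                 a + i * Δ < b + j * Δ → a + i * Δ + wait a b ≤ b + j * Δ
  wait-minimal {a} {b} a≤Δ b≤Δ i j earlier with wait-cases a b a≤Δ
  ... | inj₁ (_ , eq) = begin
    a + i * Δ + wait a b   ≡⟨ xy∙z≈xz∙y a (i * Δ) (wait a b) ⟩
    a + wait a b + i * Δ   ≡⟨ cong (_+ i * Δ) eq ⟩
    b + i * Δ              ≤⟨ +-monoʳ-≤ b (*-monoˡ-≤ Δ i≤j) ⟩
    b + j * Δ              ∎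
    where
    i≤j : i ≤ j
    i≤j with ≤-<-connex i j
    ... | inj₁ i≤j = i≤j
    ... | inj₂ j<i = contradiction earlier (≤⇒≯ (begin
      b + j * Δ     ≤⟨ +-monoˡ-≤ (j * Δ) b≤Δ ⟩
      suc j * Δ     ≤⟨ *-monoˡ-≤ Δ j<i ⟩
      i * Δ         ≤⟨ m≤n+m (i * Δ) a ⟩
      a + i * Δ     ∎))
  ... | inj₂ (b≤a , eq) = begin
    a + i * Δ + wait a b   ≡⟨ xy∙z≈xz∙y a (i * Δ) (wait a b) ⟩
    a + wait a b + i * Δ   ≡⟨ cong (_+ i * Δ) eq ⟩
    b + Δ + i * Δ          ≡⟨ +-assoc b Δ (i * Δ) ⟩
    b + suc i * Δ          ≤⟨ +-monoʳ-≤ b (*-monoˡ-≤ Δ i<j) ⟩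
    b + j * Δ              ∎
    where
    i<j : i < j
    i<j with <-≤-connex i j
    ... | inj₁ i<j = i<j
    ... | inj₂ j≤i = contradiction earlier (≤⇒≯ (+-mono-≤ b≤a (*-monoˡ-≤ Δ j≤i)))

  wait-+-wait : ∀ {a b} → a < b → b ≤ Δ → wait a b + wait b a ≡ Δ
  wait-+-wait {a} {b} a<b b≤Δ = +-cancelˡ-≡ (a + b) _ _ (begin-equality
    a + b + (wait a b + wait b a)     ≡⟨ interchange a b (wait a b) (wait b a) ⟩
    (a + wait a b) + (b + wait b a)   ≡⟨ cong₂ _+_ (wait-< a<b) (wait-≥ (<⇒≤ a<b) b≤a+Δ) ⟩
    b + (a + Δ)                       ≡⟨ x∙yz≈yx∙z b a Δ ⟩
    a + b + Δ                         ∎)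
    where
    b≤a+Δ : b ≤ a + Δ
    b≤a+Δ = ≤-trans b≤Δ (m≤n+m Δ a)

  Δ≤wait+wait : ∀ {a b} → a ≤ Δ → b ≤ Δ → Δ ≤ wait a b + wait b a
  Δ≤wait+wait {a} {b} a≤Δ b≤Δ with <-cmp a b
  ... | tri< a<b _ _  = ≤-reflexive (sym (wait-+-wait a<b b≤Δ))
  ... | tri≈ _ refl _ = subst (Δ ≤_) (sym (cong₂ _+_ (wait-self a) (wait-self a))) (m≤m+n Δ Δ)
  ... | tri> _ _ b<a  = ≤-reflexive (sym (trans (+-comm (wait a b) (wait b a)) (wait-+-wait b<a a≤Δ)))

spread⇒duration : ∀ {t₀ t₁ w} → t₀ + w ≤ t₁ → suc w ≤ t₁ ∸ t₀ + 1
spread⇒duration {t₀} {t₁} {w} t₀+w≤t₁ = subst (_≤ t₁ ∸ t₀ + 1) (+-comm w 1)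
  (+-monoˡ-≤ 1 (m+n≤o⇒m≤o∸n w (subst (_≤ t₁) (+-comm t₀ w) t₀+w≤t₁)))

increasing⇒spread : ∀ k (t : Fin (suc k) → ℕ) → (∀ (i : Fin k) → t (inject₁ i) < t (fsuc i)) →
                    t fzero + k ≤ t (fromℕ k)
increasing⇒spread zero    t _          = ≤-reflexive (+-identityʳ (t fzero))
increasing⇒spread (suc k) t increasing = begin
  t fzero + suc k      ≡⟨ +-suc (t fzero) k ⟩
  suc (t fzero) + k    ≤⟨ +-monoˡ-≤ k (increasing fzero) ⟩
  t (fsuc fzero) + k   ≤⟨ increasing⇒spread k (λ i → t (fsuc i)) (λ i → increasing (fsuc i)) ⟩
  t (fromℕ (suc k))    ∎
  where open ≤-Reasoning

dist≤minDuration : ∀ {n} {G : Graph n} {Δ lab u v D d} → MinDuration G Δ lab u v D → Dist G u v d → d ≤ D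
dist≤minDuration ((k , P , t , increasing , _ , D≡) , _) (_ , shortest) =
  ≤-trans (shortest (suc k) P) (subst (suc k ≤_) (sym D≡) (spread⇒duration (increasing⇒spread k t increasing)))

module Greedy {n : ℕ} (G : Graph n) (Δ : ℕ) (lab : Labeling n) (periodic : PeriodicLabeling G Δ lab) where

  open import Data.Nat using (_*_)
  open Walks G
  open Waiting Δ

  1≤label : ∀ {a b} → Edge G a b → 1 ≤ lab a b
  1≤label e = proj₁ (proj₂ (periodic _ _ e))

  label≤Δ : ∀ {a b} → Edge G a b → lab a b ≤ Δ
  label≤Δ e = proj₂ (proj₂ (periodic _ _ e))

  greedyWait : ∀ {u v} → Walk u v → ℕ
  greedyWait ε                                     = 0
  greedyWait (_ ◅ ε)                               = 0
  greedyWait (_◅_ {a} {b} _ (_◅_ {j = c} f p)) = wait (lab a b) (lab b c) + greedyWait (f ◅ p)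

  departures : ∀ {u v} → ℕ → (p : Walk u v) → Fin (length p) → ℕ
  departures t (_ ◅ _)                               fzero        = t
  departures t (_◅_ {a} {b} _ (_◅_ {j = c} f p)) (fsuc i)     = departures (t + wait (lab a b) (lab b c)) (f ◅ p) i

  departures-increasing : ∀ {a b v} (e : Edge G a b) (q : Walk b v) t (i : Fin (length q)) →
                          departures t (e ◅ q) (inject₁ i) < departures t (e ◅ q) (fsuc i)
  departures-increasing e (f ◅ q) t fzero    = m<m+n t (1≤wait (label≤Δ e) (1≤label f))
  departures-increasing e (f ◅ q) t (fsuc i) = departures-increasing f q _ i

  departures-available : ∀ {a b v} (e : Edge G a b) (q : Walk b v) t → Available Δ lab a b t →
                         ∀ i → Available Δ lab (vertexAt (e ◅ q) (inject₁ i)) (vertexAt (e ◅ q) (fsuc i))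
                                                (departures t (e ◅ q) i)
  departures-available e ε       t t-avail fzero = t-avail
  departures-available e (f ◅ q) t t-avail fzero = t-avail
  departures-available e (f ◅ q) t (i , t≡) (fsuc k) with j , eq ← wait-available (label≤Δ e) i =
    departures-available f q _ (j , trans (cong (_+ _) t≡) eq) k

  departures-last : ∀ {a b v} (e : Edge G a b) (q : Walk b v) t →
                    departures t (e ◅ q) (fromℕ (length q)) ≡ t + greedyWait (e ◅ q)
  departures-last e ε       t = sym (+-identityʳ t)
  departures-last e (f ◅ q) t = trans (departures-last f q _) (+-assoc t _ _)

  greedyPath : ∀ {a b v} (e : Edge G a b) (q : Walk b v) → Simple (e ◅ q) →
               TemporalPath G Δ lab a v (suc (greedyWait (e ◅ q)))
  greedyPath {a} {b} e q simple =
    length q , toPath (e ◅ q) simple , departures (lab a b) (e ◅ q) ,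
    departures-increasing e q _ , departures-available e q _ (0 , sym (+-identityʳ _)) , duration
    where
    duration : suc (greedyWait (e ◅ q)) ≡ departures (lab a b) (e ◅ q) (fromℕ (length q)) ∸ lab a b + 1
    duration = begin
      suc (greedyWait (e ◅ q))                      ≡⟨ +-comm 1 _ ⟩
      greedyWait (e ◅ q) + 1                        ≡⟨ cong (_+ 1) (m+n∸m≡n (lab a b) _) ⟨
      lab a b + greedyWait (e ◅ q) ∸ lab a b + 1     ≡⟨ cong (λ t → t ∸ lab a b + 1) (departures-last e q _) ⟨
      departures (lab a b) (e ◅ q) (fromℕ (length q)) ∸ lab a b + 1 ∎
      where open ≡-Reasoning

  greedyWait≤ : ∀ {a b v} (e : Edge G a b) (q : Walk b v) → greedyWait (e ◅ q) ≤ length q * Δ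
  greedyWait≤ e ε       = z≤n
  greedyWait≤ e (f ◅ q) = +-mono-≤ (wait≤Δ (label≤Δ e) (label≤Δ f)) (greedyWait≤ f q)

  minDuration≤ : ∀ {u v D d} → MinDuration G Δ lab u v D → Path G u v (suc d) → D ≤ suc (d * Δ)
  minDuration≤ (_ , minimal) P with _ , e , q , simple , refl ← fromPath⁺ P =
    ≤-trans (minimal _ (greedyPath e q simple)) (s≤s (greedyWait≤ e q))

  module TwoSteps (acyclic : Acyclic G) where

    open Acyclicity acyclic

    twoStep-simple : ∀ {x c y} (e : Edge G x c) (f : Edge G c y) → x ≢ y → Simple (e ◅ f ◅ ε)
    twoStep-simple e f x≢y = (Edge⇒≢ e ∷ x≢y ∷ []) ∷ (Edge⇒≢ f ∷ []) ∷ [] ∷ []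

    -- Paths in a tree are unique, so every temporal path from x to y visits x, c, y.
    twoStep-lowerBound : ∀ {x c y D} (e : Edge G x c) (f : Edge G c y) → x ≢ y →
                         TemporalPath G Δ lab x y D → suc (wait (lab x c) (lab c y)) ≤ D
    twoStep-lowerBound {x} {c} {y} {D} e f x≢y (k , P , t , increasing , available , D≡) =
      along k P t increasing available D≡ (trans (sym (vertices-fromPath P)) visits)
      where
      visits : vertices (fromPath P) ≡ x ∷ c ∷ y ∷ []
      visits = simple-walks-unique (fromPath P) (e ◅ f ◅ ε) (fromPath-simple P) (twoStep-simple e f x≢y)

      along : ∀ k (P : Path G x y (suc k)) (t : Fin (suc k) → ℕ) →
              (∀ (i : Fin k) → t (inject₁ i) < t (fsuc i)) →
              (∀ (i : Fin (suc k)) → Available Δ lab (vtx P (inject₁ i)) (vtx P (fsuc i)) (t i)) →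
              D ≡ t (fromℕ k) ∸ t fzero + 1 → tabulate (vtx P) ≡ x ∷ c ∷ y ∷ [] →
              suc (wait (lab x c) (lab c y)) ≤ D
      along zero          _ _ _ _ _ ()
      along (suc (suc _)) _ _ _ _ _ ()
      along (suc zero) P t increasing available D≡ vtx≡
        with x≡ , vtx≡′ ← ∷-injective vtx≡
        with c≡ , vtx≡″ ← ∷-injective vtx≡′
        with y≡ , _ ← ∷-injective vtx≡″
        with i , t₀≡ ← available fzero
        with j , t₁≡ ← available (fsuc fzero) =
          subst (suc (wait (lab x c) (lab c y)) ≤_) (sym D≡) (spread⇒duration waited)
        where
        t₀≡′ : t fzero ≡ lab x c + i * Δ
        t₀≡′ = trans t₀≡ (cong (_+ i * Δ) (cong₂ lab x≡ c≡))
        t₁≡′ : t (fsuc fzero) ≡ lab c y + j * Δ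
        t₁≡′ = trans t₁≡ (cong (_+ j * Δ) (cong₂ lab c≡ y≡))
        waited : t fzero + wait (lab x c) (lab c y) ≤ t (fsuc fzero)
        waited = subst₂ (λ t₀ t₁ → t₀ + wait (lab x c) (lab c y) ≤ t₁) (sym t₀≡′) (sym t₁≡′)
          (wait-minimal (label≤Δ e) (label≤Δ f) i j (subst₂ _<_ t₀≡′ t₁≡′ (increasing fzero)))

    twoStep-minDuration : ∀ {x c y} (e : Edge G x c) (f : Edge G c y) → x ≢ y →
                          MinDuration G Δ lab x y (suc (wait (lab x c) (lab c y)))
    twoStep-minDuration e f x≢y =
      subst (TemporalPath G Δ lab _ _) (cong suc (+-identityʳ _)) (greedyPath e (f ◅ ε) (twoStep-simple e f x≢y)) ,
      λ _ → twoStep-lowerBound e f x≢y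

    twoStep-pairRatio : ∀ {x c y} (e : Edge G x c) (f : Edge G c y) → x ≢ y →
                        PairRatio G Δ lab x y ((+ suc (wait (lab x c) (lab c y))) / 2)
    twoStep-pairRatio e f x≢y =
      x≢y , _ , 1 , twoStep-minDuration e f x≢y ,
      path⇒dist (toPath (e ◅ f ◅ ε) (twoStep-simple e f x≢y)) , refl

⌈n/2⌉≤1+⌊n/2⌋ : ∀ n → ⌈ n /2⌉ ≤ suc ⌊ n /2⌋
⌈n/2⌉≤1+⌊n/2⌋ zero          = z≤n
⌈n/2⌉≤1+⌊n/2⌋ (suc zero)    = s≤s z≤n
⌈n/2⌉≤1+⌊n/2⌋ (suc (suc n)) = s≤s (⌈n/2⌉≤1+⌊n/2⌋ n)

2≤n⇒⌈n/2⌉<n : ∀ {n} → 2 ≤ n → ⌈ n /2⌉ < n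
2≤n⇒⌈n/2⌉<n (s≤s (s≤s _)) = ⌈n/2⌉<n _

module LevelLabels (Δ : ℕ) (2≤Δ : 2 ≤ Δ) where

  open import Data.Nat using (_*_)
  open Waiting Δ
  open ≡-Reasoning

  L : ℕ → ℕ
  L = levelLabel Δ

  L-cases : ∀ k → (L k ≡ Δ × L (suc k) ≡ ⌈ Δ /2⌉) ⊎ (L k ≡ ⌈ Δ /2⌉ × L (suc k) ≡ Δ)
  L-cases zero          = inj₁ (refl , refl)
  L-cases (suc zero)    = inj₂ (refl , refl)
  L-cases (suc (suc k)) = L-cases k

  ⌈Δ/2⌉<Δ : ⌈ Δ /2⌉ < Δ
  ⌈Δ/2⌉<Δ = 2≤n⇒⌈n/2⌉<n 2≤Δ

  -- The wait after an edge of depth k when the next edge has depth k ± 1.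
  φ : ℕ → ℕ
  φ k = wait (L k) (L (suc k))

  φ-+-φ : ∀ k → φ k + φ (suc k) ≡ Δ
  φ-+-φ k with L-cases k
  ... | inj₁ (Lk≡ , Lk+1≡) = subst₂ (λ x y → wait x y + wait y x ≡ Δ) (sym Lk≡) (sym Lk+1≡)
          (trans (+-comm (wait Δ ⌈ Δ /2⌉) (wait ⌈ Δ /2⌉ Δ)) (wait-+-wait ⌈Δ/2⌉<Δ ≤-refl))
  ... | inj₂ (Lk≡ , Lk+1≡) = subst₂ (λ x y → wait x y + wait y x ≡ Δ) (sym Lk≡) (sym Lk+1≡)
          (wait-+-wait ⌈Δ/2⌉<Δ ≤-refl)

  φ-cases : ∀ k → φ k ≡ ⌈ Δ /2⌉ ⊎ φ k ≡ ⌊ Δ /2⌋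
  φ-cases k with L-cases k
  ... | inj₁ (Lk≡ , Lk+1≡) = inj₁ (trans (cong₂ wait Lk≡ Lk+1≡) (+-cancelˡ-≡ Δ _ _ (begin
    Δ + wait Δ ⌈ Δ /2⌉    ≡⟨ wait-≥ (⌈n/2⌉≤n Δ) (m≤n+m Δ _) ⟩
    ⌈ Δ /2⌉ + Δ           ≡⟨ +-comm ⌈ Δ /2⌉ Δ ⟩
    Δ + ⌈ Δ /2⌉           ∎)))
  ... | inj₂ (Lk≡ , Lk+1≡) = inj₂ (trans (cong₂ wait Lk≡ Lk+1≡) (+-cancelˡ-≡ ⌈ Δ /2⌉ _ _ (begin
    ⌈ Δ /2⌉ + wait ⌈ Δ /2⌉ Δ   ≡⟨ wait-< ⌈Δ/2⌉<Δ ⟩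
    Δ                          ≡⟨ sym (⌊n/2⌋+⌈n/2⌉≡n Δ) ⟩
    ⌊ Δ /2⌋ + ⌈ Δ /2⌉          ≡⟨ +-comm ⌊ Δ /2⌋ ⌈ Δ /2⌉ ⟩
    ⌈ Δ /2⌉ + ⌊ Δ /2⌋          ∎)))

  ⌊Δ/2⌋≤φ : ∀ k → ⌊ Δ /2⌋ ≤ φ k
  ⌊Δ/2⌋≤φ k with φ-cases k
  ... | inj₁ φk≡ = subst (⌊ Δ /2⌋ ≤_) (sym φk≡) (⌊n/2⌋≤⌈n/2⌉ Δ)
  ... | inj₂ φk≡ = ≤-reflexive (sym φk≡)

  φ≤1+⌊Δ/2⌋ : ∀ k → φ k ≤ suc ⌊ Δ /2⌋
  φ≤1+⌊Δ/2⌋ k with φ-cases k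
  ... | inj₁ φk≡ = subst (_≤ suc ⌊ Δ /2⌋) (sym φk≡) (⌈n/2⌉≤1+⌊n/2⌋ Δ)
  ... | inj₂ φk≡ = subst (_≤ suc ⌊ Δ /2⌋) (sym φk≡) (n≤1+n _)

  straight-step : ∀ {k k′} → k′ ≡ suc k ⊎ k ≡ suc k′ → 2 * wait (L k) (L k′) + φ k′ ≡ Δ + φ k
  straight-step {k} (inj₁ refl) = begin
    2 * φ k + φ (suc k)      ≡⟨ rearrange (φ k) (φ (suc k)) ⟩
    (φ k + φ (suc k)) + φ k  ≡⟨ cong (_+ φ k) (φ-+-φ k) ⟩
    Δ + φ k                  ∎
    where
    rearrange : ∀ x y → 2 * x + y ≡ (x + y) + x
    rearrange = solve-∀
  straight-step {k′ = k′} (inj₂ refl) = begin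
    2 * φ (suc k′) + φ k′          ≡⟨ rearrange (φ (suc k′)) (φ k′) ⟩
    (φ k′ + φ (suc k′)) + φ (suc k′) ≡⟨ cong (_+ φ (suc k′)) (φ-+-φ k′) ⟩
    Δ + φ (suc k′)                 ∎
    where
    rearrange : ∀ x y → 2 * x + y ≡ (y + x) + x
    rearrange = solve-∀

  turn-step : ∀ {k k′} → k′ ≡ k → 2 * wait (L k) (L k′) + φ k′ ≡ Δ + φ k + Δ
  turn-step {k} refl = begin
    2 * wait (L k) (L k) + φ k   ≡⟨ cong (λ w → 2 * w + φ k) (wait-self (L k)) ⟩
    2 * Δ + φ k                  ≡⟨ rearrange Δ (φ k) ⟩
    Δ + φ k + Δ                  ∎
    where
    rearrange : ∀ d x → 2 * d + x ≡ d + x + d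
    rearrange = solve-∀

module RadiusBound {n : ℕ} (G : Graph n) (Δ : ℕ) {vx : Fin n} {lab : Labeling n}
                   (tree : Tree G) (radius : RadiusLabeling G Δ vx lab) where

  open import Data.Nat using (_*_)
  open Walks G
  open Acyclicity (proj₂ tree)
  open Levels (proj₁ tree) vx
  open Waiting Δ
  open Greedy G Δ lab (proj₁ (proj₂ radius))

  telescope-step : ∀ w W b m x x′ c c′ → 2 * w + x′ + c ≤ Δ + x + c′ → 2 * W + b ≤ m * Δ + x′ + c →
                   2 * (w + W) + b ≤ suc m * Δ + x + c′
  telescope-step w W b m x x′ c c′ step rest = begin
    2 * (w + W) + b            ≡⟨ distribute w W b ⟩
    2 * w + (2 * W + b)        ≤⟨ +-monoʳ-≤ (2 * w) rest ⟩
    2 * w + (m * Δ + x′ + c)   ≡⟨ shuffle (2 * w) (m * Δ) x′ c ⟩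
    m * Δ + (2 * w + x′ + c)   ≤⟨ +-monoʳ-≤ (m * Δ) step ⟩
    m * Δ + (Δ + x + c′)       ≡⟨ shuffle′ (m * Δ) Δ x c′ ⟩
    Δ + m * Δ + x + c′         ∎
    where
    open ≤-Reasoning
    distribute : ∀ w W b → 2 * (w + W) + b ≡ 2 * w + (2 * W + b)
    distribute = solve-∀
    shuffle : ∀ y z x c → y + (z + x + c) ≡ z + (y + x + c)
    shuffle = solve-∀
    shuffle′ : ∀ z d x c → z + (d + x + c) ≡ d + z + x + c
    shuffle′ = solve-∀

  -- The crude bound W ≤ d * Δ suffices unless both d ≥ 2 and Δ ≥ 2.
  doubled-duration : ∀ {d W} → 1 ≤ Δ → W ≤ d * Δ → (2 ≤ Δ → 2 * W ≤ d * Δ + Δ + 1) →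
                     suc W * 2 ≤ suc Δ * suc d
  doubled-duration {zero} 1≤Δ z≤n _ = s≤s (subst (1 ≤_) (sym (*-identityʳ Δ)) 1≤Δ)
  doubled-duration {suc zero} {W} _ W≤Δ _ = *-monoˡ-≤ 2 (s≤s (subst (W ≤_) (+-identityʳ Δ) W≤Δ))
  doubled-duration {suc (suc d)} {W} 1≤Δ W≤ fine with 2 ≤? Δ
  ... | yes 2≤Δ = begin
    suc W * 2                                   ≡⟨ double W ⟩
    2 * W + 2                                   ≤⟨ +-monoˡ-≤ 2 (fine 2≤Δ) ⟩
    suc (suc d) * Δ + Δ + 1 + 2                 ≡⟨ +-assoc (suc (suc d) * Δ + Δ) 1 2 ⟩
    suc (suc d) * Δ + Δ + 3                     ≤⟨ +-monoʳ-≤ (suc (suc d) * Δ + Δ) (m≤m+n 3 d) ⟩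
    suc (suc d) * Δ + Δ + (3 + d)               ≡⟨ expand d Δ ⟩
    suc Δ * suc (suc (suc d))                   ∎
    where
    open ≤-Reasoning
    double : ∀ W → suc W * 2 ≡ 2 * W + 2
    double = solve-∀
    expand : ∀ d Δ → (2 + d) * Δ + Δ + (3 + d) ≡ (1 + Δ) * (3 + d)
    expand = solve-∀
  ... | no 2≰Δ = begin
    suc W * 2                    ≤⟨ *-monoˡ-≤ 2 (s≤s W≤2+d) ⟩
    suc (suc (suc d)) * 2        ≡⟨ *-comm (suc (suc (suc d))) 2 ⟩
    2 * suc (suc (suc d))        ≤⟨ *-monoˡ-≤ (suc (suc (suc d))) (s≤s 1≤Δ) ⟩
    suc Δ * suc (suc (suc d))    ∎
    where
    open ≤-Reasoning
    W≤2+d : W ≤ suc (suc d)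
    W≤2+d = begin
      W                      ≤⟨ W≤ ⟩
      suc (suc d) * Δ        ≤⟨ *-monoʳ-≤ (suc (suc d)) (≤-pred (≰⇒> 2≰Δ)) ⟩
      suc (suc d) * 1        ≡⟨ *-identityʳ (suc (suc d)) ⟩
      suc (suc d)            ∎

  -- The index is the depth of the edge: the level of its endpoint farther from vx.
  data Orientation (a b : Fin n) : ℕ → Set where
    ascending  : level b ≡ suc (level a) → Orientation a b (level b)
    descending : level a ≡ suc (level b) → Orientation a b (level a)

  orientation : ∀ {a b} → Edge G a b → ∃ (Orientation a b)
  orientation e with edge-level e
  ... | inj₁ up   = _ , ascending up
  ... | inj₂ down = _ , descending down

  label≡ : ∀ {a b k} → Edge G a b → Orientation a b k → lab a b ≡ levelLabel Δ k
  label≡ {a} {b} e (ascending up) =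
    trans (proj₂ (proj₂ radius) a b (level a) e (level-dist a) (subst (Dist G vx b) up (level-dist b)))
          (cong (levelLabel Δ) (sym up))
  label≡ {a} {b} e (descending down) =
    trans (proj₁ (proj₁ (proj₂ radius) a b e)) (label≡ (Edge-sym e) (ascending down))

  allowance : ∀ {a b k} → Orientation a b k → ℕ
  allowance (ascending _)  = 0
  allowance (descending _) = Δ

  allowance≤Δ : ∀ {a b k} (o : Orientation a b k) → allowance o ≤ Δ
  allowance≤Δ (ascending _)  = z≤n
  allowance≤Δ (descending _) = ≤-refl

  module _ (2≤Δ : 2 ≤ Δ) where

    open LevelLabels Δ 2≤Δ

    -- 2 · (waits) + φ (depth) grows by Δ at a straight step and by 2Δ at the turn at
    -- the lowest vertex; the allowance is Δ while the walk descends, so that the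
    -- turn may still come, and 0 once it ascends.
    potential-bound : ∀ {z a v k} (e : Edge G z a) (q : Walk a v) → Simple (e ◅ q) → (o : Orientation z a k) →
                      2 * greedyWait (e ◅ q) + ⌊ Δ /2⌋ ≤ length q * Δ + φ k + allowance o
    potential-bound {k = k} e ε _ o = ≤-trans (⌊Δ/2⌋≤φ k) (m≤m+n (φ k) (allowance o))
    potential-bound {z} {a} {k = k} e (_◅_ {j = b} f q) (z∉ ∷ simple) o with k′ , o′ ← orientation f =
      telescope-step (wait (lab z a) (lab a b)) (greedyWait (f ◅ q)) ⌊ Δ /2⌋ (length q)
                     (φ k) (φ k′) (allowance o′) (allowance o) (step o o′) (potential-bound f q simple o′)
      where
      relabel : ∀ {k k′} (o : Orientation z a k) (o′ : Orientation a b k′) {c c′} →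
                2 * wait (L k) (L k′) + φ k′ + c ≤ Δ + φ k + c′ →
                2 * wait (lab z a) (lab a b) + φ k′ + c ≤ Δ + φ k + c′
      relabel o o′ {c} {c′} = subst (λ w → 2 * w + _ + c ≤ _) (sym (cong₂ wait (label≡ e o) (label≡ f o′)))

      step : ∀ {k k′} (o : Orientation z a k) (o′ : Orientation a b k′) →
             2 * wait (lab z a) (lab a b) + φ k′ + allowance o′ ≤ Δ + φ k + allowance o
      step o@(ascending _)   o′@(ascending up′)    =
        relabel o o′ (≤-reflexive (cong (_+ 0) (straight-step (inj₁ up′))))
      step o@(descending down) o′@(descending _)  =
        relabel o o′ (≤-reflexive (cong (_+ Δ) (straight-step (inj₂ down))))
      step o@(descending down) o′@(ascending up′) =
        relabel o o′ (≤-reflexive (trans (+-identityʳ _) (turn-step (trans up′ (sym down)))))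
      step (ascending up)    (descending down′)   =
        ⊥-elim (All.lookup z∉ (there (start∈ q)) (parent-unique e (Edge-sym f) up down′))

    greedyWait-radius : ∀ {a b v} (e : Edge G a b) (q : Walk b v) → Simple (e ◅ q) →
                        2 * greedyWait (e ◅ q) ≤ length q * Δ + Δ + 1
    greedyWait-radius e q simple with k , o ← orientation e = +-cancelʳ-≤ ⌊ Δ /2⌋ _ _ (begin
      2 * greedyWait (e ◅ q) + ⌊ Δ /2⌋    ≤⟨ potential-bound e q simple o ⟩
      length q * Δ + φ k + allowance o     ≤⟨ +-mono-≤ (+-monoʳ-≤ (length q * Δ) (φ≤1+⌊Δ/2⌋ k))
                                                       (allowance≤Δ o) ⟩
      length q * Δ + suc ⌊ Δ /2⌋ + Δ       ≡⟨ shuffle (length q * Δ) ⌊ Δ /2⌋ Δ ⟩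
      length q * Δ + Δ + 1 + ⌊ Δ /2⌋       ∎)
      where
      open ≤-Reasoning
      shuffle : ∀ m h d → m + suc h + d ≡ m + d + 1 + h
      shuffle = solve-∀

  radius-minDuration : ∀ {u v D d} → MinDuration G Δ lab u v D → Dist G u v (suc d) → D * 2 ≤ suc Δ * suc d
  radius-minDuration (_ , minimal) (P , _) with _ , e , q , simple , refl ← fromPath⁺ P =
    ≤-trans (*-monoˡ-≤ 2 (minimal _ (greedyPath e q simple)))
            (doubled-duration (≤-trans (1≤label e) (label≤Δ e)) (greedyWait≤ e q)
                              (λ 2≤Δ → greedyWait-radius 2≤Δ e q simple))

count≡length-filter : ∀ {A : Set} (p : A → Bool) xs →
                      sum (map (λ x → if p x then 1 else 0) xs) ≡ List.length (filter (λ x → p x Bool.≟ true) xs)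
count≡length-filter p []       = refl
count≡length-filter p (x ∷ xs) with p x
... | true  = cong suc (count≡length-filter p xs)
... | false = count≡length-filter p xs

lookup-injective : ∀ {A : Set} {xs : List A} → Unique xs → ∀ {i j} → lookup xs i ≡ lookup xs j → i ≡ j
lookup-injective {xs = _ ∷ _} _           {fzero}  {fzero}  _  = refl
lookup-injective {xs = _ ∷ _} (x∉xs ∷ _) {fzero}  {fsuc j} eq = ⊥-elim (All.lookup x∉xs (∈-lookup j) eq)
lookup-injective {xs = _ ∷ _} (x∉xs ∷ _) {fsuc i} {fzero}  eq = ⊥-elim (All.lookup x∉xs (∈-lookup i) (sym eq))
lookup-injective {xs = _ ∷ _} (_ ∷ u)     {fsuc i} {fsuc j} eq = cong fsuc (lookup-injective u eq)

pigeonhole : ∀ {A : Set} {m} (f : A → ℕ) {ys : List A} → Unique ys → (∀ {y} → y ∈ ys → f y < m) →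
             m < List.length ys → ∃₂ λ y y′ → y ∈ ys × y′ ∈ ys × y ≢ y′ × f y ≡ f y′
pigeonhole f {ys} unique bounded longer
  with i , j , i<j , same ← Finₚ.pigeonhole longer (λ i → fromℕ< (bounded (∈-lookup i))) =
  lookup ys i , lookup ys j , ∈-lookup i , ∈-lookup j ,
  (λ eq → Finₚ.<-irrefl (lookup-injective unique eq) i<j) ,
  trans (sym (Finₚ.toℕ-fromℕ< _)) (trans (cong toℕ same) (Finₚ.toℕ-fromℕ< _))

module _ {n : ℕ} (G : Graph n) where

  neighbours : Fin n → List (Fin n)
  neighbours c = filter (λ u → adj G c u Bool.≟ true) (allFin n)

  maxDegree-attained : ∀ {k} → suc k ≤ maxDegree G → ∃ λ c → suc k ≤ List.length (neighbours c)
  maxDegree-attained {k} k<max with foldr-selective ⊔-sel 0 (map (degree G) (allFin n))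
  ... | inj₁ max≡0 = contradiction (subst (suc k ≤_) max≡0 k<max) λ ()
  ... | inj₂ max∈ with c , _ , max≡ ← ∈-map⁻ (degree G) max∈ =
    c , subst (suc k ≤_) (trans max≡ (count≡length-filter (adj G c) (allFin n))) k<max

  module _ {Δ : ℕ} {lab : Labeling n} (periodic : PeriodicLabeling G Δ lab) where

    neighbour-edge : ∀ {c u} → u ∈ neighbours c → Edge G c u
    neighbour-edge {c} u∈ = proj₂ (∈-filter⁻ (λ u → adj G c u Bool.≟ true) {xs = allFin n} u∈)

    neighbour-label< : ∀ {c u} → u ∈ neighbours c → lab c u ∸ 1 < Δ
    neighbour-label< {c} {u} u∈ with lab c u | proj₂ (periodic _ _ (neighbour-edge u∈))
    ... | suc ℓ | _ , ℓ<Δ = ℓ<Δ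

    positive-label : ∀ {c u} → Edge G c u → lab c u ≡ suc (lab c u ∸ 1)
    positive-label {c} {u} e with lab c u | proj₁ (proj₂ (periodic _ _ e))
    ... | suc ℓ | _ = refl

    repeated-label : suc Δ ≤ maxDegree G →
                     ∃ λ c → ∃₂ λ x y → Edge G c x × Edge G c y × x ≢ y × lab c x ≡ lab c y
    repeated-label Δ<max
      with c , Δ<deg ← maxDegree-attained Δ<max
      with x , y , x∈ , y∈ , x≢y , same ←
           pigeonhole (λ u → lab c u ∸ 1) (Unique.filter⁺ _ (Unique.allFin⁺ n)) neighbour-label< Δ<deg
      = c , x , y , neighbour-edge x∈ , neighbour-edge y∈ , x≢y ,
        trans (positive-label (neighbour-edge x∈)) (trans (cong suc same) (sym (positive-label (neighbour-edge y∈))))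

module Ratios where

  open import Data.Nat using (_*_)

  toℚᵘ-/ : ∀ i m → toℚᵘ (i / suc m) ≃ᵘ mkℚᵘ i m
  toℚᵘ-/ i m = ℚ.toℚᵘ-fromℚᵘ (mkℚᵘ i m)

  ratio-≤ : ∀ a m c k → a * suc k ≤ c * suc m → (+ a) / suc m ≤ℚ (+ c) / suc k
  ratio-≤ a m c k cross = ℚ.toℚᵘ-cancel-≤
    (ℚᵘ.≤-respˡ-≃ (ℚᵘ.≃-sym (toℚᵘ-/ (+ a) m)) (ℚᵘ.≤-respʳ-≃ (ℚᵘ.≃-sym (toℚᵘ-/ (+ c) k))
      (*≤* (subst₂ ℤ._≤_ (ℤ.pos-* a (suc k)) (ℤ.pos-* c (suc m)) (+≤+ cross)))))

  double-ratio : ∀ c k → (+ 2) / 1 ℚ.* ((+ c) / suc k) ≡ (+ (2 * c)) / suc k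
  double-ratio c k = ℚ.toℚᵘ-injective (begin-equality
    toℚᵘ ((+ 2) / 1 ℚ.* ((+ c) / suc k))         ≃⟨ ℚ.toℚᵘ-homo-* ((+ 2) / 1) ((+ c) / suc k) ⟩
    toℚᵘ ((+ 2) / 1) ℚᵘ.* toℚᵘ ((+ c) / suc k)   ≃⟨ ℚᵘ.*-cong (toℚᵘ-/ (+ 2) 0) (toℚᵘ-/ (+ c) k) ⟩
    mkℚᵘ (+ 2) 0 ℚᵘ.* mkℚᵘ (+ c) k               ≃⟨ *≡* (cong₂ ℤ._*_ (sym (ℤ.pos-* 2 c))
                                                                  (cong (λ z → + suc z) (sym (+-identityʳ k)))) ⟩
    mkℚᵘ (+ (2 * c)) k                            ≃⟨ toℚᵘ-/ (+ (2 * c)) k ⟨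
    toℚᵘ ((+ (2 * c)) / suc k)                    ∎)
    where open ℚᵘ.≤-Reasoning

  ratio-≤-double : ∀ a m c k → a * suc k ≤ 2 * c * suc m → (+ a) / suc m ≤ℚ (+ 2) / 1 ℚ.* ((+ c) / suc k)
  ratio-≤-double a m c k cross = subst ((+ a) / suc m ≤ℚ_) (sym (double-ratio c k)) (ratio-≤ a m (2 * c) k cross)

module Stretch {n : ℕ} {G : Graph n} {Δ : ℕ} {vx : Fin n} {lab lab′ : Labeling n}
               (tree : Tree G) (radius : RadiusLabeling G Δ vx lab) (periodic′ : PeriodicLabeling G Δ lab′) where

  open import Data.Nat using (_*_)
  open Walks G
  open Acyclicity (proj₂ tree)
  open Waiting Δ
  open Greedy G Δ lab′ periodic′
  open TwoSteps (proj₂ tree)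
  open RadiusBound G Δ tree radius using (radius-minDuration)
  open Ratios

  repeated-wait : ∀ {c x y} → Edge G c x → lab′ c x ≡ lab′ c y → wait (lab′ x c) (lab′ c y) ≡ Δ
  repeated-wait {c} {x} {y} cx same = begin
    wait (lab′ x c) (lab′ c y)   ≡⟨ cong (λ a → wait a (lab′ c y)) (proj₁ (periodic′ x c (Edge-sym cx))) ⟩
    wait (lab′ c x) (lab′ c y)   ≡⟨ cong (λ a → wait a (lab′ c y)) same ⟩
    wait (lab′ c y) (lab′ c y)   ≡⟨ wait-self (lab′ c y) ⟩
    Δ                            ∎
    where open ≡-Reasoning

  radius-optimal : suc Δ ≤ maxDegree G → ∀ {s s′} →
                   IsStretch G Δ lab s → IsStretch G Δ lab′ s′ → s ≤ℚ s′
  radius-optimal Δ<max {s} {s′} ((_ , _ , _ , D , d , minimal , dist , s≡) , _) (_ , maximal′)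
    with c , x , y , cx , cy , x≢y , same ← repeated-label G periodic′ Δ<max = begin
    s                                          ≡⟨ s≡ ⟩
    (+ D) / suc d                              ≤⟨ ratio-≤ D d (suc Δ) 1 (radius-minDuration minimal dist) ⟩
    (+ suc Δ) / 2                              ≡⟨ cong (λ w → (+ suc w) / 2) (sym (repeated-wait cx same)) ⟩
    (+ suc (wait (lab′ x c) (lab′ c y))) / 2   ≤⟨ maximal′ x y _ (twoStep-pairRatio (Edge-sym cx) cy x≢y) ⟩
    s′                                         ∎
    where open ℚ.≤-Reasoning

  twoStep-stretch : ∀ {s′ x c y} → (∀ u v r → PairRatio G Δ lab′ u v r → r ≤ℚ s′) →
                    Edge G x c → Edge G c y → x ≢ y → ∃ λ X → Δ ≤ X + X × (+ suc X) / 2 ≤ℚ s′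
  twoStep-stretch {s′} {x} {c} {y} maximal′ e f x≢y = larger (≤-total backward forward)
    where
    forward backward : ℕ
    forward  = wait (lab′ x c) (lab′ c y)
    backward = wait (lab′ c y) (lab′ x c)

    round-trip : Δ ≤ forward + backward
    round-trip = Δ≤wait+wait (label≤Δ e) (label≤Δ f)

    forward-ratio : (+ suc forward) / 2 ≤ℚ s′
    forward-ratio = maximal′ x y _ (twoStep-pairRatio e f x≢y)

    backward-ratio : (+ suc backward) / 2 ≤ℚ s′
    backward-ratio = subst (λ w → (+ suc w) / 2 ≤ℚ s′)
      (cong₂ wait (sym (proj₁ (periodic′ c y f))) (sym (proj₁ (periodic′ x c e))))
      (maximal′ y x _ (twoStep-pairRatio (Edge-sym f) (Edge-sym e) (λ y≡x → x≢y (sym y≡x))))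

    larger : backward ≤ forward ⊎ forward ≤ backward → ∃ λ X → Δ ≤ X + X × (+ suc X) / 2 ≤ℚ s′
    larger (inj₁ b≤f) = forward  , ≤-trans round-trip (+-monoʳ-≤ forward b≤f)  , forward-ratio
    larger (inj₂ f≤b) = backward , ≤-trans round-trip (+-monoˡ-≤ backward f≤b) , backward-ratio

  unit-cross : ∀ {D D′ d′} → D ≤ 1 → suc d′ ≤ D′ → D * suc d′ ≤ 2 * D′ * 1
  unit-cross {D} {D′} {d′} D≤1 d′<D′ = begin
    D * suc d′    ≤⟨ *-monoˡ-≤ (suc d′) D≤1 ⟩
    1 * suc d′    ≡⟨ *-identityˡ (suc d′) ⟩
    suc d′        ≤⟨ d′<D′ ⟩
    D′            ≤⟨ m≤m+n D′ (D′ + 0) ⟩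
    2 * D′        ≡⟨ *-identityʳ (2 * D′) ⟨
    2 * D′ * 1    ∎
    where open ≤-Reasoning

  radius-2-approx : ∀ {s s′} → IsStretch G Δ lab s → IsStretch G Δ lab′ s′ → s ≤ℚ (+ 2) / 1 ℚ.* s′
  radius-2-approx {s} {s′} ((_ , _ , _ , D , zero , minimal , (P , _) , s≡) , _)
                           ((_ , _ , _ , D′ , d′ , minimal′ , dist′ , s′≡) , _) = begin
    s                                  ≡⟨ s≡ ⟩
    (+ D) / 1                          ≤⟨ ratio-≤-double D 0 D′ d′ cross ⟩
    (+ 2) / 1 ℚ.* ((+ D′) / suc d′)    ≡⟨ cong ((+ 2) / 1 ℚ.*_) (sym s′≡) ⟩
    (+ 2) / 1 ℚ.* s′                   ∎
    where
    open ℚ.≤-Reasoning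
    cross : D * suc d′ ≤ 2 * D′ * 1
    cross = unit-cross (Greedy.minDuration≤ G Δ lab (proj₁ (proj₂ radius)) minimal P)
                       (dist≤minDuration {Δ = Δ} {lab = lab′} minimal′ dist′)
  radius-2-approx {s} {s′} ((_ , _ , _ , D , suc d , minimal , dist , s≡) , _) (_ , maximal′)
    with c , y , e , f , x≢y ← path⇒twoStep (proj₁ dist)
    with X , Δ≤X+X , r≤s′ ← twoStep-stretch maximal′ e f x≢y = begin
    s                                       ≡⟨ s≡ ⟩
    (+ D) / suc (suc d)                     ≤⟨ ratio-≤-double D (suc d) (suc X) 1 cross ⟩
    (+ 2) / 1 ℚ.* ((+ suc X) / 2)           ≤⟨ ℚ.*-monoˡ-≤-nonNeg ((+ 2) / 1) r≤s′ ⟩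
    (+ 2) / 1 ℚ.* s′                        ∎
    where
    open ℚ.≤-Reasoning
    cross : D * 2 ≤ 2 * suc X * suc (suc d)
    cross = ≤-trans (radius-minDuration minimal dist)
      (*-monoˡ-≤ (suc (suc d)) (≤-trans (s≤s Δ≤X+X) (≤-trans (n≤1+n _) (≤-reflexive (twice-suc X)))))
      where
      twice-suc : ∀ X → suc (suc (X + X)) ≡ 2 * suc X
      twice-suc = solve-∀

-- Natural-number multiplication is only opened inside the modules above, so that
-- from here on _*_ is multiplication of rationals.
open import Data.Rational using (_*_)

mainTheorem5 : (Δ : ℕ) →
  (∀ (n : ℕ) (G : Graph n) → Tree G → suc Δ ≤ maxDegree G →
    ∀ (vx : Fin n) (lab : Labeling n) → RadiusLabeling G Δ vx lab →
    ∀ (lab′ : Labeling n) → PeriodicLabeling G Δ lab′ →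
    ∀ (s s′ : ℚ) → IsStretch G Δ lab s → IsStretch G Δ lab′ s′ → s ≤ℚ s′)
  × (∀ (n : ℕ) (G : Graph n) → Tree G →
    ∀ (vx : Fin n) (lab : Labeling n) → RadiusLabeling G Δ vx lab →
    ∀ (lab′ : Labeling n) → PeriodicLabeling G Δ lab′ →
    ∀ (s s′ : ℚ) → IsStretch G Δ lab s → IsStretch G Δ lab′ s′ → s ≤ℚ ((+ 2) / 1) * s′)
mainTheorem5 Δ =
  (λ n G tree Δ<max vx lab radius lab′ periodic′ s s′ →
     Stretch.radius-optimal tree radius periodic′ Δ<max) ,
  (λ n G tree vx lab radius lab′ periodic′ s s′ →
     Stretch.radius-2-approx tree radius periodic′)
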